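{- Let $X$ and $Y$ be words. Then $X\sim Y$ if and only if there is a sequence of swaps between $X$ and $Y$ in which every swap is of type $(U,D)$ for some upper prime $U$ and some lower prime $D$.
   Context: Let $\mathcal{A}$ be the free associative $\mathbb{C}$-algebra on two generators $L$ and $R$ (letters). A word is a finite product of letters (possibly empty). A word is balanced if $L$ and $R$ occur in it equally many times. Let $S=\{FG-GF\colon F,G \text{ nonempty balanced words}\}$, let $\mathcal{J}$ be the two-sided ideal generated by $S$, and write $X\sim Y$ if $X-Y\in\mathcal{J}$. Two words are related by a swap of type $(F,G)$ if they are $W_1FGW_2$ and $W_1GFW_2$ for some words $W_1,W_2$; a sequence of swaps between $X$ and $Y$ is a sequence of words $Z_1=X,\dots,Z_k=Y$ with consecutive words related by a swap. A word is prime if it is nonempty, balanced, and not a product of two nonempty balanced words. For a word $W=a_1\cdots a_n$, $e_k(W)=\sum_{i=1}^k\overline{a_i}$ with $\overline{R}=1$, $\overline{L}=-1$. A prime $P$ of length $l(P)$ is an upper prime if $e_k(P)>0$ for $1\le k\le l(P)-1$, and a lower prime if $e_k(P)<0$ for $1\le k\le l(P)-1$. -}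

module Defs where

open import Level using (Level; _⊔_)
open import Data.Nat using (ℕ; zero; suc; _≤_; _<_)
open import Data.Integer as ℤ using (ℤ; +_)
open import Data.List using (List; []; _∷_; _++_; length; take; map; filter)
open import Data.List.Properties using (≡-dec)
open import Data.List.Relation.Unary.All using (All)
open import Data.Product using (Σ; _×_; _,_; ∃; ∃-syntax)
open import Data.Sum using (_⊎_)
open import Relation.Nullary using (¬_; Dec; yes; no)
open import Relation.Binary.PropositionalEquality using (_≡_; _≢_)
open import Relation.Binary.Construct.Closure.ReflexiveTransitive using (Star)
open import Algebra.Bundles using (CommutativeRing)

data Letter : Set where
  L R : Letter

_≟L_ : (a b : Letter) → Dec (a ≡ b)
L ≟L L = yes _≡_.refl
L ≟L R = no λ ()
R ≟L L = no λ ()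
R ≟L R = yes _≡_.refl

Word : Set
Word = List Letter

_≟W_ : (u v : Word) → Dec (u ≡ v)
_≟W_ = ≡-dec _≟L_

#L : Word → ℕ
#L []       = 0
#L (L ∷ w)  = suc (#L w)
#L (R ∷ w)  = #L w

#R : Word → ℕ
#R []       = 0
#R (L ∷ w)  = #R w
#R (R ∷ w)  = suc (#R w)

Balanced : Word → Set
Balanced w = #L w ≡ #R w

NonEmpty : Word → Set
NonEmpty w = w ≢ []

Prime : Word → Set
Prime P = NonEmpty P × Balanced P ×
  (¬ (Σ Word λ A → Σ Word λ B →
        NonEmpty A × Balanced A × NonEmpty B × Balanced B × P ≡ A ++ B))

bar : Letter → ℤ
bar L = ℤ.-[1+ 0 ]
bar R = + 1

sumℤ : List ℤ → ℤ
sumℤ []       = + 0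
sumℤ (x ∷ xs) = x ℤ.+ sumℤ xs

e : ℕ → Word → ℤ
e k W = sumℤ (map bar (take k W))

UpperPrime : Word → Set
UpperPrime P = Prime P × (∀ k → 1 ≤ k → k < length P → + 0 ℤ.< e k P)

LowerPrime : Word → Set
LowerPrime P = Prime P × (∀ k → 1 ≤ k → k < length P → e k P ℤ.< + 0)

SwapOfType : Word → Word → Word → Word → Set
SwapOfType F G X Y = Σ Word λ W₁ → Σ Word λ W₂ →
  (X ≡ W₁ ++ F ++ G ++ W₂ × Y ≡ W₁ ++ G ++ F ++ W₂) ⊎
  (X ≡ W₁ ++ G ++ F ++ W₂ × Y ≡ W₁ ++ F ++ G ++ W₂)

UDSwap : Word → Word → Set
UDSwap X Y = Σ Word λ U → Σ Word λ D →
  UpperPrime U × LowerPrime D × SwapOfType U D X Y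

UDSwapSequence : Word → Word → Set
UDSwapSequence = Star UDSwap

-- An element of the free algebra is determined by its coefficient function
-- Word → K (finitely supported); the two-sided ideal generated by S is the
-- K-span of the elements W₁ (F G − G F) W₂ with F, G nonempty balanced.

module FreeAlgebra {c ℓ} (K : CommutativeRing c ℓ) where
  open CommutativeRing K

  δ : Word → Word → Carrier
  δ V W with V ≟W W
  ... | yes _ = 1#
  ... | no  _ = 0#

  -- a generator term  k · W₁ (F G − G F) W₂  of the ideal
  record GenTerm : Set c where
    constructor gen
    field
      coef : Carrier
      W₁ F G W₂ : Word

  ValidGen : GenTerm → Set
  ValidGen t = NonEmpty F × Balanced F × NonEmpty G × Balanced G
    where open GenTerm t

  genCoeff : GenTerm → Word → Carrier
  genCoeff (gen k W₁ F G W₂) W =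
    k * (δ (W₁ ++ F ++ G ++ W₂) W - δ (W₁ ++ G ++ F ++ W₂) W)

  sumCoeff : List GenTerm → Word → Carrier
  sumCoeff []       W = 0#
  sumCoeff (t ∷ ts) W = genCoeff t W + sumCoeff ts W

  -- X ∼ Y  iff  X − Y ∈ J, i.e. X − Y is a finite K-linear combination of
  -- elements W₁ (F G − G F) W₂ with F, G nonempty balanced words
  _∼_ : Word → Word → Set (c ⊔ ℓ)
  X ∼ Y = Σ (List GenTerm) λ ts → All ValidGen ts ×
            (∀ W → δ X W - δ Y W ≈ sumCoeff ts W)

-- Stand-in for ℂ: a field of characteristic zero (ℂ is not available).

module _ {c ℓ} (K : CommutativeRing c ℓ) where
  open CommutativeRing K

  _×1# : ℕ → Carrier
  zero  ×1# = 0#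
  suc n ×1# = 1# + (n ×1#)

  record IsCharZeroField : Set (c ⊔ ℓ) where
    field
      1≉0      : ¬ (1# ≈ 0#)
      inverse  : ∀ x → ¬ (x ≈ 0#) → Σ Carrier λ y → x * y ≈ 1#
      charZero : ∀ n → (n ×1#) ≈ 0# → n ≡ 0

-- The ideal J is spanned by the differences W₁FGW₂ − W₁GFW₂, so X ∼ Y says that δX − δY
-- is a combination of differences δA − δB of words related by swaps of balanced factors.
-- For any equivalence containing these swaps such a combination forces X and Y to be
-- related: merging A into B kills one difference and leaves the others between related
-- words, and when no difference is left δX = δY.
--
-- It remains to realise a swap of balanced words F, G by (U, D)-swaps, by induction on
-- |F| + |G|. If F or G splits into nonempty balanced factors, swap the factors one at a
-- time. Otherwise both are prime. The prefix heights of a prime never vanish, so a prime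
-- beginning with R stays positive (it is an upper prime of the form R A L with A
-- balanced), and dually for L. Primes with different first letters are exchanged by a
-- single (U, D)-swap, and R A L · R B L = R (A · LR · B) L is turned into R (B · LR · A) L
-- by swapping the shorter balanced words A, B and LR among themselves.

module Submission where

open import Defs
open import Algebra.Bundles using (CommutativeRing)
open import Data.Product using (_×_; Σ; _,_; proj₁; proj₂)
import Data.Product as ×
open import Data.Sum using (inj₁; inj₂)
import Data.Sum as ⊎
open import Data.Empty using (⊥-elim)
open import Data.Nat as ℕ using (zero; suc; _≤_; _<_; z≤n; s≤s)
import Data.Nat.Properties as ℕP
open import Data.Integer as ℤ using (ℤ; +_)
import Data.Integer.Properties as ℤP
open import Data.List
  using (List; []; _∷_; _++_; [_]; _∷ʳ_; length; take; drop; map; initLast; _∷ʳ′_)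
open import Data.List.Properties
  using (++-assoc; ++-identityʳ; ++-conicalʳ; length-++; length-map; take++drop≡id)
open import Data.List.Relation.Unary.All using (All; []; _∷_)
import Data.List.Relation.Unary.All as All
import Data.List.Relation.Unary.All.Properties as AllP
open import Function using (_∘_)
open import Relation.Nullary using (¬_; Dec; yes; no)
open import Relation.Nullary.Decidable using (_×-dec_; map′)
open import Relation.Binary using (Rel; Reflexive; IsEquivalence)
open import Relation.Binary.PropositionalEquality
  using (_≡_; _≢_; refl; sym; trans; cong; cong₂; subst; subst₂; module ≡-Reasoning)
open import Relation.Binary.Construct.Closure.ReflexiveTransitive using (ε; _◅_; _◅◅_; gmap; reverse)
open import Relation.Binary.Construct.Closure.ReflexiveTransitive.Properties using (module StarReasoning)
import Algebra.Properties.AbelianGroup as AbelianGroupProperties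
import Algebra.Properties.CommutativeSemigroup as CommutativeSemigroupProperties
import Algebra.Properties.Ring as RingProperties

module Ideal {c ℓ} (K : CommutativeRing c ℓ) where
  open CommutativeRing K renaming (refl to ≈-refl; sym to ≈-sym; trans to ≈-trans)
  open FreeAlgebra K
  open RingProperties ring using (-0#≈0#; -‿distribˡ-*)
  open import Relation.Binary.Reasoning.Setoid setoid
  open CommutativeSemigroupProperties +-commutativeSemigroup
    using () renaming (interchange to +-interchange)
  open AbelianGroupProperties +-abelianGroup using (xyx⁻¹≈y; ⁻¹-∙-comm; \\-leftDividesʳ)

  Difference : Set c
  Difference = Carrier × Word × Word

  ⟦_⟧ : Difference → Word → Carrier
  ⟦ k , A , B ⟧ W = k * (δ A W - δ B W)

  ∑ : List Difference → Word → Carrier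
  ∑ []       W = 0#
  ∑ (d ∷ ds) W = ⟦ d ⟧ W + ∑ ds W

  δ-≡ : ∀ {V W} → V ≡ W → δ V W ≈ 1#
  δ-≡ {V} {W} eq with V ≟W W
  ... | yes _ = ≈-refl
  ... | no ne = ⊥-elim (ne eq)

  δ-≢ : ∀ {V W} → V ≢ W → δ V W ≈ 0#
  δ-≢ {V} {W} ne with V ≟W W
  ... | yes eq = ⊥-elim (ne eq)
  ... | no _   = ≈-refl

  δ-injective : ¬ 1# ≈ 0# → ∀ {X Y} → (∀ W → δ X W - δ Y W ≈ 0#) → X ≡ Y
  δ-injective 1≉0 {X} {Y} H with X ≟W Y
  ... | yes eq = eq
  ... | no ne  = ⊥-elim (1≉0 (begin
    1#              ≈⟨ +-identityʳ 1# ⟨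
    1# + 0#         ≈⟨ +-congˡ -0#≈0# ⟨
    1# - 0#         ≈⟨ +-cong (δ-≡ {X} refl) (-‿cong (δ-≢ (ne ∘ sym))) ⟨
    δ X X - δ Y X   ≈⟨ H X ⟩
    0#              ∎))

  x≈1#*x+0# : ∀ x → x ≈ 1# * x + 0#
  x≈1#*x+0# x = ≈-sym (≈-trans (+-identityʳ _) (*-identityˡ x))

  x+[y-x]≈y : ∀ x y → x + (y - x) ≈ y
  x+[y-x]≈y x y = ≈-trans (≈-sym (+-assoc x y (- x))) (xyx⁻¹≈y x y)

  module Redirect (A B : Word) where
    redirect : Word → Word
    redirect V with V ≟W A
    ... | yes _ = B
    ... | no  _ = V

    redirect-A : redirect A ≡ B
    redirect-A with A ≟W A
    ... | yes _ = refl
    ... | no ne = ⊥-elim (ne refl)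

    redirect-B : redirect B ≡ B
    redirect-B with B ≟W A
    ... | yes _ = refl
    ... | no _  = refl

    redirectᴰ : Difference → Difference
    redirectᴰ (k , U , V) = k , redirect U , redirect V

    -- the coefficient function of the image of f under the linear extension of redirect
    push : (Word → Carrier) → Word → Carrier
    push f W = f W + f A * (δ B W - δ A W)

    δ-redirect : ∀ V W → δ (redirect V) W ≈ push (δ V) W
    δ-redirect V W with V ≟W A
    ... | yes refl = begin
      δ B W                              ≈⟨ x+[y-x]≈y (δ A W) (δ B W) ⟨
      δ A W + (δ B W - δ A W)            ≈⟨ +-congˡ (*-identityˡ _) ⟨
      δ A W + 1# * (δ B W - δ A W)       ∎
    ... | no ne = begin
      δ V W                              ≈⟨ +-identityʳ _ ⟨
      δ V W + 0#                         ≈⟨ +-congˡ (zeroˡ _) ⟨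
      δ V W + 0# * (δ B W - δ A W)       ∎

    push-cong : ∀ {f g} → (∀ W → f W ≈ g W) → ∀ W → push f W ≈ push g W
    push-cong f≈g W = +-cong (f≈g W) (*-congʳ (f≈g A))

    push-+ : ∀ f g W → push (λ V → f V + g V) W ≈ push f W + push g W
    push-+ f g W = begin
      (f W + g W) + (f A + g A) * γ        ≈⟨ +-congˡ (distribʳ γ (f A) (g A)) ⟩
      (f W + g W) + (f A * γ + g A * γ)    ≈⟨ +-interchange (f W) (g W) (f A * γ) (g A * γ) ⟩
      push f W + push g W                  ∎
      where γ = δ B W - δ A W

    push-* : ∀ k f W → push (λ V → k * f V) W ≈ k * push f W
    push-* k f W = begin
      k * f W + k * f A * γ                ≈⟨ +-congˡ (*-assoc k (f A) γ) ⟩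
      k * f W + k * (f A * γ)              ≈⟨ distribˡ k (f W) (f A * γ) ⟨
      k * push f W                         ∎
      where γ = δ B W - δ A W

    push-- : ∀ f g W → push (λ V → f V - g V) W ≈ push f W - push g W
    push-- f g W = begin
      (f W - g W) + (f A - g A) * γ        ≈⟨ +-congˡ (distribʳ γ (f A) (- g A)) ⟩
      (f W - g W) + (f A * γ + - g A * γ)  ≈⟨ +-congˡ (+-congˡ (-‿distribˡ-* (g A) γ)) ⟨
      (f W - g W) + (f A * γ - g A * γ)    ≈⟨ +-interchange (f W) (- g W) (f A * γ) (- (g A * γ)) ⟩
      push f W + (- g W - g A * γ)         ≈⟨ +-congˡ (⁻¹-∙-comm (g W) (g A * γ)) ⟩
      push f W - push g W                  ∎
      where γ = δ B W - δ A W

    push-⟦⟧ : ∀ d W → push ⟦ d ⟧ W ≈ ⟦ redirectᴰ d ⟧ W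
    push-⟦⟧ (k , U , V) W = begin
      push (λ W → k * (δ U W - δ V W)) W          ≈⟨ push-* k (λ W → δ U W - δ V W) W ⟩
      k * push (λ W → δ U W - δ V W) W            ≈⟨ *-congˡ (push-- (δ U) (δ V) W) ⟩
      k * (push (δ U) W - push (δ V) W)
        ≈⟨ *-congˡ (+-cong (δ-redirect U W) (-‿cong (δ-redirect V W))) ⟨
      k * (δ (redirect U) W - δ (redirect V) W)   ∎

    push-∑ : ∀ ds W → push (∑ ds) W ≈ ∑ (map redirectᴰ ds) W
    push-∑ []       W = ≈-trans (+-identityˡ _) (zeroˡ _)
    push-∑ (d ∷ ds) W =
      ≈-trans (push-+ ⟦ d ⟧ (∑ ds) W) (+-cong (push-⟦⟧ d W) (push-∑ ds W))

    redirect-related : ∀ {r} {_~_ : Rel Word r} → Reflexive _~_ → A ~ B → ∀ V → V ~ redirect V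
    redirect-related ~-refl A~B V with V ≟W A
    ... | yes refl = A~B
    ... | no _     = ~-refl

  sumCoeff-++ : ∀ ts us W → sumCoeff (ts ++ us) W ≈ sumCoeff ts W + sumCoeff us W
  sumCoeff-++ []       us W = ≈-sym (+-identityˡ _)
  sumCoeff-++ (t ∷ ts) us W = ≈-trans (+-congˡ (sumCoeff-++ ts us W)) (≈-sym (+-assoc _ _ _))

  ∼-refl : ∀ {X} → X ∼ X
  ∼-refl {X} = [] , [] , λ W → -‿inverseʳ (δ X W)

  ∼-trans : ∀ {X Y Z} → X ∼ Y → Y ∼ Z → X ∼ Z
  ∼-trans {X} {Y} {Z} (ts , valid-ts , Hts) (us , valid-us , Hus) =
    ts ++ us , AllP.++⁺ valid-ts valid-us , λ W → begin
    δ X W - δ Z W                        ≈⟨ +-congˡ (\\-leftDividesʳ (δ Y W) (- δ Z W)) ⟨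
    δ X W + (- δ Y W + (δ Y W - δ Z W))  ≈⟨ +-assoc (δ X W) (- δ Y W) _ ⟨
    (δ X W - δ Y W) + (δ Y W - δ Z W)    ≈⟨ +-cong (Hts W) (Hus W) ⟩
    sumCoeff ts W + sumCoeff us W        ≈⟨ sumCoeff-++ ts us W ⟨
    sumCoeff (ts ++ us) W                ∎

  swapOfType⇒∼ : ∀ {F G X Y} → NonEmpty F → Balanced F → NonEmpty G → Balanced G →
                 SwapOfType F G X Y → X ∼ Y
  swapOfType⇒∼ neF bF neG bG (W₁ , W₂ , inj₁ (refl , refl)) =
    gen 1# W₁ _ _ W₂ ∷ [] , (neF , bF , neG , bG) ∷ [] , λ W → x≈1#*x+0# _
  swapOfType⇒∼ neF bF neG bG (W₁ , W₂ , inj₂ (refl , refl)) =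
    gen 1# W₁ _ _ W₂ ∷ [] , (neG , bG , neF , bF) ∷ [] , λ W → x≈1#*x+0# _

  udSwap⇒∼ : ∀ {X Y} → UDSwap X Y → X ∼ Y
  udSwap⇒∼ (_ , _ , ((neU , bU , _) , _) , ((neD , bD , _) , _) , s) = swapOfType⇒∼ neU bU neD bD s

  udSwapSequence⇒∼ : ∀ {X Y} → UDSwapSequence X Y → X ∼ Y
  udSwapSequence⇒∼ {X}     ε                    = ∼-refl {X}
  udSwapSequence⇒∼ {X} {Y} (_◅_ {j = Z} s swaps) =
    ∼-trans {X} {Z} {Y} (udSwap⇒∼ s) (udSwapSequence⇒∼ swaps)

  toDifference : GenTerm → Difference
  toDifference (gen k W₁ F G W₂) = k , W₁ ++ F ++ G ++ W₂ , W₁ ++ G ++ F ++ W₂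

  sumCoeff≡∑ : ∀ ts W → sumCoeff ts W ≡ ∑ (map toDifference ts) W
  sumCoeff≡∑ []       W = refl
  sumCoeff≡∑ (t ∷ ts) W = cong (_+_ (genCoeff t W)) (sumCoeff≡∑ ts W)

  module _ {r} {_~_ : Rel Word r} (~-equivalence : IsEquivalence _~_) (1≉0 : ¬ 1# ≈ 0#) where
    open IsEquivalence ~-equivalence
      renaming (refl to ~-refl; sym to ~-sym; trans to ~-trans; reflexive to ~-reflexive)

    RelatedDifference : Difference → Set r
    RelatedDifference (_ , U , V) = U ~ V

    spanned⇒related-length : ∀ n ds → length ds ≡ n → All RelatedDifference ds →
                             ∀ {X Y} → (∀ W → δ X W - δ Y W ≈ ∑ ds W) → X ~ Y
    spanned⇒related-length zero [] _ [] H = ~-reflexive (δ-injective 1≉0 H)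
    -- Redirecting A to B turns the first difference into 0 and keeps the others related.
    spanned⇒related-length (suc n) ((k , A , B) ∷ ds) |ds| (A~B ∷ related) {X} {Y} H =
      ~-trans (redirect~ X)
        (~-trans (spanned⇒related-length n (map redirectᴰ ds) |σds| σrelated H′)
                 (~-sym (redirect~ Y)))
      where
      open Redirect A B
      redirect~ : ∀ V → V ~ redirect V
      redirect~ = redirect-related {_~_ = _~_} ~-refl A~B
      |σds| : length (map redirectᴰ ds) ≡ n
      |σds| = trans (length-map redirectᴰ ds) (ℕP.suc-injective |ds|)
      redirect-preserves : ∀ d → RelatedDifference d → RelatedDifference (redirectᴰ d)
      redirect-preserves (_ , U , V) U~V = ~-trans (~-sym (redirect~ U))
                                             (~-trans U~V (redirect~ V))
      σrelated : All RelatedDifference (map redirectᴰ ds)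
      σrelated = AllP.map⁺ (All.map (λ {d} → redirect-preserves d) related)
      collapsed : ∀ W → k * (δ (redirect A) W - δ (redirect B) W) ≈ 0#
      collapsed W = subst₂ (λ U V → k * (δ U W - δ V W) ≈ 0#) (sym redirect-A) (sym redirect-B)
        (≈-trans (*-congˡ (-‿inverseʳ (δ B W))) (zeroʳ k))
      H′ : ∀ W → δ (redirect X) W - δ (redirect Y) W ≈ ∑ (map redirectᴰ ds) W
      H′ W = begin
        δ (redirect X) W - δ (redirect Y) W   ≈⟨ +-cong (δ-redirect X W) (-‿cong (δ-redirect Y W)) ⟩
        push (δ X) W - push (δ Y) W           ≈⟨ push-- (δ X) (δ Y) W ⟨
        push (λ V → δ X V - δ Y V) W          ≈⟨ push-cong H W ⟩
        push (∑ ((k , A , B) ∷ ds)) W         ≈⟨ push-∑ ((k , A , B) ∷ ds) W ⟩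
        k * (δ (redirect A) W - δ (redirect B) W) + ∑ (map redirectᴰ ds) W
                                              ≈⟨ +-congʳ (collapsed W) ⟩
        0# + ∑ (map redirectᴰ ds) W           ≈⟨ +-identityˡ _ ⟩
        ∑ (map redirectᴰ ds) W                ∎

    spanned⇒related : ∀ {ds} → All RelatedDifference ds →
                      ∀ {X Y} → (∀ W → δ X W - δ Y W ≈ ∑ ds W) → X ~ Y
    spanned⇒related {ds} = spanned⇒related-length _ ds refl

    ∼⇒related : (∀ W₁ F G W₂ → NonEmpty F → Balanced F → NonEmpty G → Balanced G →
                 (W₁ ++ F ++ G ++ W₂) ~ (W₁ ++ G ++ F ++ W₂)) →
                ∀ {X Y} → X ∼ Y → X ~ Y
    ∼⇒related swaps~ (ts , valid , H) =
      spanned⇒related (AllP.map⁺ (All.map (λ {t} → generator~ t) valid))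
                      (λ W → ≈-trans (H W) (reflexive (sumCoeff≡∑ ts W)))
      where
      generator~ : ∀ t → ValidGen t → RelatedDifference (toDifference t)
      generator~ (gen _ W₁ F G W₂) (neF , bF , neG , bG) = swaps~ W₁ F G W₂ neF bF neG bG

open import Data.Integer using (_+_; _-_; -_)

flip : Letter → Letter
flip L = R
flip R = L

bar-flip : ∀ x → bar (flip x) ≡ - bar x
bar-flip L = refl
bar-flip R = refl

height : Word → ℤ
height w = sumℤ (map bar w)

height-++ : ∀ A B → height (A ++ B) ≡ height A + height B
height-++ []      B = sym (ℤP.+-identityˡ (height B))
height-++ (x ∷ A) B =
  trans (cong (_+_ (bar x)) (height-++ A B)) (sym (ℤP.+-assoc (bar x) (height A) (height B)))

height-∷ʳ : ∀ A y → height (A ∷ʳ y) ≡ height A + bar y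
height-∷ʳ A y = trans (height-++ A [ y ]) (cong (_+_ (height A)) (ℤP.+-identityʳ (bar y)))

height≡#R-#L : ∀ w → height w ≡ + #R w - + #L w
height≡#R-#L []      = refl
height≡#R-#L (R ∷ w) =
  trans (cong (_+_ (+ 1)) (height≡#R-#L w)) (sym (ℤP.+-assoc (+ 1) (+ #R w) (- + #L w)))
height≡#R-#L (L ∷ w) = begin
  ℤ.-1ℤ + height w             ≡⟨ cong (_+_ ℤ.-1ℤ) (height≡#R-#L w) ⟩
  ℤ.-1ℤ + (+ #R w - + #L w)    ≡⟨ x∙yz≈y∙xz ℤ.-1ℤ (+ #R w) (- + #L w) ⟩
  + #R w + (ℤ.-1ℤ - + #L w)    ≡⟨ cong (_+_ (+ #R w)) (-1-n≡-[1+n] (#L w)) ⟩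
  + #R w - + suc (#L w)        ∎
  where
  open ≡-Reasoning
  open CommutativeSemigroupProperties ℤP.+-commutativeSemigroup using (x∙yz≈y∙xz)
  -1-n≡-[1+n] : ∀ n → ℤ.-1ℤ - + n ≡ - + suc n
  -1-n≡-[1+n] zero    = refl
  -1-n≡-[1+n] (suc n) = refl

balanced⇒height≡0 : ∀ w → Balanced w → height w ≡ + 0
balanced⇒height≡0 w b = trans (height≡#R-#L w) (ℤP.i≡j⇒i-j≡0 (cong +_ (sym b)))

height≡0⇒balanced : ∀ w → height w ≡ + 0 → Balanced w
height≡0⇒balanced w h =
  ℤP.+-injective (sym (ℤP.i-j≡0⇒i≡j _ _ (trans (sym (height≡#R-#L w)) h)))

balanced-++⁻ʳ : ∀ A B → Balanced (A ++ B) → Balanced A → Balanced B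
balanced-++⁻ʳ A B bAB bA = height≡0⇒balanced B (begin
  height B               ≡⟨ ℤP.+-identityˡ (height B) ⟨
  + 0 + height B         ≡⟨ cong (_+ height B) (balanced⇒height≡0 A bA) ⟨
  height A + height B    ≡⟨ height-++ A B ⟨
  height (A ++ B)        ≡⟨ balanced⇒height≡0 (A ++ B) bAB ⟩
  + 0                    ∎)
  where open ≡-Reasoning

balanced-wrap : ∀ x A → Balanced (x ∷ A ∷ʳ flip x) → Balanced A
balanced-wrap x A b = height≡0⇒balanced A (begin
  height A                         ≡⟨ xyx⁻¹≈y (bar x) (height A) ⟨
  bar x + height A - bar x         ≡⟨ cong (_+_ (height (x ∷ A))) (bar-flip x) ⟨
  height (x ∷ A) + bar (flip x)    ≡⟨ height-∷ʳ (x ∷ A) (flip x) ⟨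
  height (x ∷ A ∷ʳ flip x)         ≡⟨ balanced⇒height≡0 (x ∷ A ∷ʳ flip x) b ⟩
  + 0                              ∎)
  where
  open ≡-Reasoning
  open AbelianGroupProperties ℤP.+-0-abelianGroup using (xyx⁻¹≈y)

Splitting : Word → Set
Splitting P = Σ Word λ A → Σ Word λ B →
  NonEmpty A × Balanced A × NonEmpty B × Balanced B × P ≡ A ++ B

++-split? : {P Q : Word → Set} → (∀ w → Dec (P w)) → (∀ w → Dec (Q w)) →
            ∀ w → Dec (Σ Word λ A → Σ Word λ B → P A × Q B × w ≡ A ++ B)
++-split? P? Q? [] with P? [] ×-dec Q? []
... | yes (p , q) = yes ([] , [] , p , q , refl)
... | no ¬pq = no λ { ([] , [] , p , q , refl) → ¬pq (p , q)
                    ; ([] , _ ∷ _ , _ , _ , ())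
                    ; (_ ∷ _ , _ , _ , _ , ()) }
++-split? P? Q? (x ∷ w) with P? [] ×-dec Q? (x ∷ w)
... | yes (p , q) = yes ([] , x ∷ w , p , q , refl)
... | no ¬pq with ++-split? (λ A → P? (x ∷ A)) Q? w
...   | yes (A , B , p , q , eq) = yes (x ∷ A , B , p , q , cong (x ∷_) eq)
...   | no ¬split = no λ { ([] , B , p , q , refl) → ¬pq (p , q)
                         ; (_ ∷ A , B , p , q , refl) → ¬split (A , B , p , q , refl) }

nonEmptyBalanced? : ∀ w → Dec (NonEmpty w × Balanced w)
nonEmptyBalanced? []      = no λ (ne , _) → ne refl
nonEmptyBalanced? (x ∷ w) = map′ ((λ ()) ,_) proj₂ (#L (x ∷ w) ℕ.≟ #R (x ∷ w))

splitting? : ∀ w → Dec (Splitting w)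
splitting? w = map′
  (λ (A , B , (neA , bA) , (neB , bB) , eq) → A , B , neA , bA , neB , bB , eq)
  (λ (A , B , neA , bA , neB , bB , eq) → A , B , (neA , bA) , (neB , bB) , eq)
  (++-split? nonEmptyBalanced? nonEmptyBalanced? w)

Signed : Letter → ℤ → Set
Signed R a = + 0 ℤ.< a
Signed L a = a ℤ.< + 0

signed-bar : ∀ x → Signed x (bar x)
signed-bar R = ℤ.+<+ (s≤s z≤n)
signed-bar L = ℤ.-<+

signed-step : ∀ x a y → Signed x a → a + bar y ≢ + 0 → Signed x (a + bar y)
signed-step R (+ zero)          _ (ℤ.+<+ ()) _
signed-step R (+ suc n)         R _ _  = ℤ.+<+ (s≤s z≤n)
signed-step R (+ 1)             L _ nz = ⊥-elim (nz refl)
signed-step R (+ suc (suc n))   L _ _  = ℤ.+<+ (s≤s z≤n)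
signed-step L (+ _)             _ (ℤ.+<+ ()) _
signed-step L ℤ.-[1+ n ]        L _ _  = ℤ.-<+
signed-step L ℤ.-[1+ 0 ]        R _ nz = ⊥-elim (nz refl)
signed-step L ℤ.-[1+ suc n ]    R _ _  = ℤ.-<+

signed-+bar≢0 : ∀ x a → Signed x a → a + bar x ≢ + 0
signed-+bar≢0 R (+ suc n)    _ ()
signed-+bar≢0 L ℤ.-[1+ n ]   _ ()
signed-+bar≢0 L (+ _)        (ℤ.+<+ ()) _

signed-walk : ∀ x a Q → Signed x a → (∀ Q₁ Q₂ → Q ≡ Q₁ ++ Q₂ → a + height Q₁ ≢ + 0) →
              Signed x (a + height Q)
signed-walk x a []      s _  = subst (Signed x) (sym (ℤP.+-identityʳ a)) s
signed-walk x a (q ∷ Q) s nz = subst (Signed x) (ℤP.+-assoc a (bar q) (height Q))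
  (signed-walk x (a + bar q) Q (signed-step x a q s nz-q) nz-Q)
  where
  nz-q : a + bar q ≢ + 0
  nz-q = nz [ q ] Q refl ∘ trans (cong (_+_ a) (ℤP.+-identityʳ (bar q)))
  nz-Q : ∀ Q₁ Q₂ → Q ≡ Q₁ ++ Q₂ → a + bar q + height Q₁ ≢ + 0
  nz-Q Q₁ Q₂ eq =
    nz (q ∷ Q₁) Q₂ (cong (q ∷_) eq) ∘ trans (sym (ℤP.+-assoc a (bar q) (height Q₁)))

prime-prefix-height≢0 : ∀ {P} → Prime P → ∀ Q S → P ≡ Q ++ S → NonEmpty Q → NonEmpty S →
                        height Q ≢ + 0
prime-prefix-height≢0 (_ , bP , unsplit) Q S eq neQ neS hQ =
  unsplit (Q , S , neQ , bQ , neS , balanced-++⁻ʳ Q S (subst Balanced eq bP) bQ , eq)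
  where bQ = height≡0⇒balanced Q hQ

prime-signed : ∀ {x w} → Prime (x ∷ w) → ∀ Q S → w ≡ Q ++ S → NonEmpty S →
               Signed x (height (x ∷ Q))
prime-signed {x} p Q S eq neS = signed-walk x (bar x) Q (signed-bar x) λ Q₁ Q₂ eq₁ →
  prime-prefix-height≢0 p (x ∷ Q₁) (Q₂ ++ S)
    (cong (x ∷_) (trans eq (trans (cong (_++ S) eq₁) (++-assoc Q₁ Q₂ S))))
    (λ ()) (neS ∘ ++-conicalʳ Q₂ S)

drop-nonEmpty : ∀ k w → k < length w → NonEmpty (drop k w)
drop-nonEmpty zero    (_ ∷ _) _       ()
drop-nonEmpty (suc k) (_ ∷ w) (s≤s k<) = drop-nonEmpty k w k<

prime-signed-prefixes : ∀ {x w} → Prime (x ∷ w) →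
                        ∀ k → 1 ≤ k → k < length (x ∷ w) → Signed x (e k (x ∷ w))
prime-signed-prefixes {w = w} p (suc k) _ (s≤s k<) =
  prime-signed p (take k w) (drop k w) (sym (take++drop≡id k w)) (drop-nonEmpty k w k<)

prime⇒upperPrime : ∀ {w} → Prime (R ∷ w) → UpperPrime (R ∷ w)
prime⇒upperPrime p = p , prime-signed-prefixes p

prime⇒lowerPrime : ∀ {w} → Prime (L ∷ w) → LowerPrime (L ∷ w)
prime⇒lowerPrime p = p , prime-signed-prefixes p

¬prime-same-ends : ∀ x A → ¬ Prime (x ∷ A ∷ʳ x)
¬prime-same-ends x A p@(_ , b , _) =
  signed-+bar≢0 x (height (x ∷ A)) (prime-signed p A [ x ] refl λ ())
    (trans (sym (height-∷ʳ (x ∷ A) x)) (balanced⇒height≡0 (x ∷ A ∷ʳ x) b))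

prime-shape : ∀ {x w} → Prime (x ∷ w) → Σ Word λ A → w ≡ A ∷ʳ flip x × Balanced A
prime-shape {x} {w} p with initLast w
prime-shape {L} (_ , () , _) | []
prime-shape {R} (_ , () , _) | []
prime-shape {R} p | A ∷ʳ′ L = A , refl , balanced-wrap R A (proj₁ (proj₂ p))
prime-shape {L} p | A ∷ʳ′ R = A , refl , balanced-wrap L A (proj₁ (proj₂ p))
prime-shape {R} p | A ∷ʳ′ R = ⊥-elim (¬prime-same-ends R A p)
prime-shape {L} p | A ∷ʳ′ L = ⊥-elim (¬prime-same-ends L A p)

infix 4 _⇝_
_⇝_ : Word → Word → Set
_⇝_ = UDSwapSequence

swapOfType-sym : ∀ {F G X Y} → SwapOfType F G X Y → SwapOfType F G Y X
swapOfType-sym (W₁ , W₂ , s) = W₁ , W₂ , ⊎.swap (⊎.map ×.swap ×.swap s)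

swapOfType-++ˡ : ∀ {F G X Y} W → SwapOfType F G X Y → SwapOfType F G (W ++ X) (W ++ Y)
swapOfType-++ˡ W (W₁ , W₂ , inj₁ (refl , refl)) =
  W ++ W₁ , W₂ , inj₁ (sym (++-assoc W W₁ _) , sym (++-assoc W W₁ _))
swapOfType-++ˡ W (W₁ , W₂ , inj₂ (refl , refl)) =
  W ++ W₁ , W₂ , inj₂ (sym (++-assoc W W₁ _) , sym (++-assoc W W₁ _))

++-assoc₄ : ∀ (A B C D E : Word) → (A ++ B ++ C ++ D) ++ E ≡ A ++ B ++ C ++ D ++ E
++-assoc₄ A B C D E =
  trans (++-assoc A _ E) (cong (A ++_) (trans (++-assoc B _ E) (cong (B ++_) (++-assoc C D E))))

swapOfType-++ʳ : ∀ {F G X Y} W → SwapOfType F G X Y → SwapOfType F G (X ++ W) (Y ++ W)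
swapOfType-++ʳ {F} {G} W (W₁ , W₂ , inj₁ (refl , refl)) =
  W₁ , W₂ ++ W , inj₁ (++-assoc₄ W₁ F G W₂ W , ++-assoc₄ W₁ G F W₂ W)
swapOfType-++ʳ {F} {G} W (W₁ , W₂ , inj₂ (refl , refl)) =
  W₁ , W₂ ++ W , inj₂ (++-assoc₄ W₁ G F W₂ W , ++-assoc₄ W₁ F G W₂ W)

⇝-sym : ∀ {X Y} → X ⇝ Y → Y ⇝ X
⇝-sym = reverse λ (U , D , u , d , s) → U , D , u , d , swapOfType-sym {U} {D} s

⇝-++ˡ : ∀ W {X Y} → X ⇝ Y → W ++ X ⇝ W ++ Y
⇝-++ˡ W = gmap (W ++_) λ (U , D , u , d , s) → U , D , u , d , swapOfType-++ˡ {U} {D} W s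

⇝-++ʳ : ∀ W {X Y} → X ⇝ Y → X ++ W ⇝ Y ++ W
⇝-++ʳ W = gmap (_++ W) λ (U , D , u , d , s) → U , D , u , d , swapOfType-++ʳ {U} {D} W s

⇝-isEquivalence : IsEquivalence _⇝_
⇝-isEquivalence = record { refl = ε ; sym = ⇝-sym ; trans = _◅◅_ }

record Commute (F G : Word) : Set where
  constructor commute
  field swaps : F ++ G ⇝ G ++ F

commute-sym : ∀ {F G} → Commute F G → Commute G F
commute-sym (commute s) = commute (⇝-sym s)

commute-[]ˡ : ∀ G → Commute [] G
commute-[]ˡ G = commute (subst (G ⇝_) (sym (++-identityʳ G)) ε)

commute-++ˡ : ∀ {A B G} → Commute A G → Commute B G → Commute (A ++ B) G
commute-++ˡ {A} {B} {G} (commute AG) (commute BG) = commute (begin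
  (A ++ B) ++ G   ≡⟨ ++-assoc A B G ⟩
  A ++ B ++ G     ⟶*⟨ ⇝-++ˡ A BG ⟩
  A ++ G ++ B     ≡⟨ ++-assoc A G B ⟨
  (A ++ G) ++ B   ⟶*⟨ ⇝-++ʳ B AG ⟩
  (G ++ A) ++ B   ≡⟨ ++-assoc G A B ⟩
  G ++ A ++ B     ∎)
  where open StarReasoning UDSwap

commute-around : ∀ {A B C} → Commute C B → Commute A B → Commute A C → A ++ C ++ B ⇝ B ++ C ++ A
commute-around {A} {B} {C} (commute CB) (commute AB) (commute AC) = begin
  A ++ C ++ B     ⟶*⟨ ⇝-++ˡ A CB ⟩
  A ++ B ++ C     ≡⟨ ++-assoc A B C ⟨
  (A ++ B) ++ C   ⟶*⟨ ⇝-++ʳ C AB ⟩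
  (B ++ A) ++ C   ≡⟨ ++-assoc B A C ⟩
  B ++ A ++ C     ⟶*⟨ ⇝-++ˡ B AC ⟩
  B ++ C ++ A     ∎
  where open StarReasoning UDSwap

commute-upper-lower : ∀ {U D} → UpperPrime U → LowerPrime D → Commute U D
commute-upper-lower {U} {D} u d = commute (swap ◅ ε)
  where
  swap : UDSwap (U ++ D) (D ++ U)
  swap = U , D , u , d , [] , [] ,
         inj₁ (cong (U ++_) (sym (++-identityʳ D)) , cong (D ++_) (sym (++-identityʳ U)))

balanced-flip-pair : ∀ x → Balanced (flip x ∷ x ∷ [])
balanced-flip-pair L = refl
balanced-flip-pair R = refl

length-<-++ʳ : ∀ A {B : Word} → NonEmpty B → length A < length (A ++ B)
length-<-++ʳ A {[]}    ne = ⊥-elim (ne refl)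
length-<-++ʳ A {_ ∷ _} _  = subst (length A <_) (sym (length-++ A)) (ℕP.m<m+n (length A) (s≤s z≤n))

length-<-++ˡ : ∀ {A : Word} B → NonEmpty A → length B < length (A ++ B)
length-<-++ˡ {[]}    B ne = ⊥-elim (ne refl)
length-<-++ˡ {A@(_ ∷ _)} B _ =
  subst (length B <_) (sym (length-++ A)) (ℕP.m<n+m (length B) (s≤s z≤n))

CommuteBelow : Word → Word → Set
CommuteBelow F G = ∀ F′ G′ → length F′ ℕ.+ length G′ < length F ℕ.+ length G →
                   Balanced F′ → Balanced G′ → Commute F′ G′

commute-same-head : ∀ x {F G} → Prime (x ∷ F) → Prime (x ∷ G) →
                    CommuteBelow (x ∷ F) (x ∷ G) → Commute (x ∷ F) (x ∷ G)
commute-same-head x p q ih with prime-shape p | prime-shape q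
... | A , refl , bA | B , refl , bB =
  commute (subst₂ _⇝_ (regroup A B) (regroup B A)
    (⇝-++ˡ [ x ] (⇝-++ʳ [ flip x ]
      (commute-around (ih C B (shrink (ℕP.m<n+m (2 ℕ.+ b) {2 ℕ.+ a} (s≤s z≤n))) bC bB)
                      (ih A B (shrink (ℕP.+-mono-< (n<2+n a) (n<2+n b))) bA bB)
                      (ih A C (shrink (ℕP.+-mono-<-≤ (n<2+n a) (ℕP.m≤m+n 2 b))) bA bC)))))
  where
  C = flip x ∷ x ∷ []
  bC = balanced-flip-pair x
  a = length A
  b = length B
  regroup : ∀ A B → x ∷ (A ++ C ++ B) ∷ʳ flip x ≡ (x ∷ A ∷ʳ flip x) ++ (x ∷ B ∷ʳ flip x)
  regroup A B = cong (x ∷_) (trans (++-assoc A (C ++ B) [ flip x ]) (sym (++-assoc A [ flip x ] _)))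
  length-wrap : ∀ A → length (x ∷ A ∷ʳ flip x) ≡ 2 ℕ.+ length A
  length-wrap A = cong suc (trans (length-++ A) (ℕP.+-comm (length A) 1))
  shrink : ∀ {m} → m < (2 ℕ.+ a) ℕ.+ (2 ℕ.+ b) →
           m < length (x ∷ A ∷ʳ flip x) ℕ.+ length (x ∷ B ∷ʳ flip x)
  n<2+n : ∀ n → n < 2 ℕ.+ n
  n<2+n n = ℕP.m<n+m n (s≤s z≤n)
  shrink {m} = subst (m <_) (sym (cong₂ ℕ._+_ (length-wrap A) (length-wrap B)))

commute-primes : ∀ {x y F G} → Prime (x ∷ F) → Prime (y ∷ G) →
                 CommuteBelow (x ∷ F) (y ∷ G) → Commute (x ∷ F) (y ∷ G)
commute-primes {R} {L} p q _  = commute-upper-lower (prime⇒upperPrime p) (prime⇒lowerPrime q)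
commute-primes {L} {R} p q _  =
  commute-sym (commute-upper-lower (prime⇒upperPrime q) (prime⇒lowerPrime p))
commute-primes {R} {R} p q ih = commute-same-head R p q ih
commute-primes {L} {L} p q ih = commute-same-head L p q ih

commute-unsplittable : ∀ F G → Balanced F → Balanced G → ¬ Splitting F → ¬ Splitting G →
                       CommuteBelow F G → Commute F G
commute-unsplittable []      G       _  _  _   _   _  = commute-[]ˡ G
commute-unsplittable (x ∷ F) []      _  _  _   _   _  = commute-sym (commute-[]ˡ (x ∷ F))
commute-unsplittable (x ∷ F) (y ∷ G) bF bG ¬sF ¬sG ih =
  commute-primes ((λ ()) , bF , ¬sF) ((λ ()) , bG , ¬sG) ih

commute-balanced-step : ∀ F G → Balanced F → Balanced G → CommuteBelow F G → Commute F G
commute-balanced-step F G bF bG ih with splitting? F | splitting? G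
... | yes (A , B , neA , bA , neB , bB , refl) | _ =
  commute-++ˡ (ih A G (ℕP.+-monoˡ-< (length G) (length-<-++ʳ A neB)) bA bG)
              (ih B G (ℕP.+-monoˡ-< (length G) (length-<-++ˡ B neA)) bB bG)
... | no _ | yes (A , B , neA , bA , neB , bB , refl) =
  commute-sym (commute-++ˡ (commute-sym (ih F A (ℕP.+-monoʳ-< (length F) (length-<-++ʳ A neB)) bF bA))
                           (commute-sym (ih F B (ℕP.+-monoʳ-< (length F) (length-<-++ˡ B neA)) bF bB)))
... | no ¬sF | no ¬sG = commute-unsplittable F G bF bG ¬sF ¬sG ih

commute-balanced-bounded : ∀ n F G → length F ℕ.+ length G < n →
                           Balanced F → Balanced G → Commute F G
commute-balanced-bounded zero    F G ()    bF bG
commute-balanced-bounded (suc n) F G size< bF bG = commute-balanced-step F G bF bG λ F′ G′ smaller →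
  commute-balanced-bounded n F′ G′ (ℕP.<-≤-trans smaller (ℕP.≤-pred size<))

commute-balanced : ∀ F G → Balanced F → Balanced G → Commute F G
commute-balanced F G = commute-balanced-bounded _ F G (ℕP.n<1+n _)

swap-in-context : ∀ W₁ F G W₂ → Balanced F → Balanced G →
                  W₁ ++ F ++ G ++ W₂ ⇝ W₁ ++ G ++ F ++ W₂
swap-in-context W₁ F G W₂ bF bG = ⇝-++ˡ W₁ (subst₂ _⇝_ (++-assoc F G W₂) (++-assoc G F W₂)
  (⇝-++ʳ W₂ (Commute.swaps (commute-balanced F G bF bG))))

corollary5p4 : ∀ {c ℓ} (K : CommutativeRing c ℓ) → IsCharZeroField K →
    (X Y : Word) →
    (FreeAlgebra._∼_ K X Y → UDSwapSequence X Y) × (UDSwapSequence X Y → FreeAlgebra._∼_ K X Y)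
corollary5p4 K charZero X Y =
  ∼⇒related ⇝-isEquivalence (IsCharZeroField.1≉0 charZero)
    (λ W₁ F G W₂ _ bF _ bG → swap-in-context W₁ F G W₂ bF bG) ,
  udSwapSequence⇒∼
  where open Ideal K using (∼⇒related; udSwapSequence⇒∼)
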